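{- Let $k\in\mathbb{N}$. A map $\varepsilon\colon X^{\times}_{\mathrm{irr}}\to\mathcal{P}(M)$ is a $k$-restricted Fitch map if and only if (i) $\mathcal{N}[\varepsilon]$ is hierarchy-like, (ii) for every $N=N_m[y]\in\mathcal{N}[\varepsilon]$ and every $y'\in N$ we have $|N_m[y']|\le|N|$, and (iii) for every $N\in\mathcal{N}[\varepsilon]$ with $N\neq X$ we have $|\{m\in M:\text{there is } y\in X \text{ with } N=N_m[y]\}|\le k$.
   Context: $X$ is a finite nonempty set, $M$ a finite nonempty set of colors, $X^{\times}_{\mathrm{irr}}=\{(x,y)\in X\times X: x\neq y\}$. A phylogenetic tree on $X$ is a rooted tree whose leaves (non-root vertices of degree $1$) form $X$, whose root has degree $\ge2$ and whose non-root inner vertices have degree $\ge3$; $\mathrm{lca}(x,y)$ is the last common ancestor. An edge-labeled tree $(T,\lambda)$ on $X$ with $M$ is a phylogenetic tree $T$ on $X$ with $\lambda\colon E(T)\to\mathcal{P}(M)$; $e$ is an $m$-edge if $m\in\lambda(e)$. $(T,\lambda)$ explains $\varepsilon$ if for all $(x,y)\in X^{\times}_{\mathrm{irr}}$, $m\in M$: $m\in\varepsilon(x,y)$ iff the path from $\mathrm{lca}(x,y)$ to $y$ contains an $m$-edge; $\varepsilon$ is a $k$-restricted Fitch map if some edge-labeled tree $(T,\lambda)$ with $|\lambda(e)|\le k$ for all $e\in E(T)$ explains it. $N_m[y]=\{x\in X\setminus\{y\}: m\notin\varepsilon(x,y)\}\cup\{y\}$, $\mathcal{N}[\varepsilon]=\{N_m[y]: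 y\in X, m\in M\}$. A set system is hierarchy-like if any two members $P,Q$ satisfy $P\cap Q\in\{P,Q,\emptyset\}$. -}

module Defs where

open import Data.Nat using (ℕ; zero; suc; _≤_; _<_)
open import Data.Bool using (Bool; true; false; not)
open import Data.Fin using (Fin; toℕ; inject₁; fromℕ)
open import Data.Fin.Subset using (Subset; _∈_; _∩_; ⊥; ⊤; ∣_∣)
open import Data.Fin.Subset.Properties using (_∈?_)
open import Data.Fin.Properties using (any?) renaming (_≟_ to _≟F_)
open import Data.Vec using (tabulate)
open import Data.Vec.Properties using (≡-dec)
open import Data.Bool.Properties using () renaming (_≟_ to _≟B_)
open import Data.Product using (Σ; ∃; ∃-syntax; _×_)
open import Data.Sum using (_⊎_)
open import Relation.Nullary using (¬_; Dec; yes; no; does)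
open import Relation.Binary.PropositionalEquality using (_≡_; _≢_)
open import Function.Bundles using (_⇔_)

-- Conventions
--   X = Fin n  (n ≥ 1 is imposed in the theorem), M = Fin c (c ≥ 1).
--   A map ε : X^×_irr → P(M) is a function taking x, y and an
--   (irrelevant) proof that x ≢ y.

EpsMap : ℕ → ℕ → Set
EpsMap n c = (x y : Fin n) → .(x ≢ y) → Subset c

-- Vertices are Fin (suc v); the root is  fromℕ v ;
-- non-root vertices are  inject₁ i  for i : Fin v, and the edge of the
-- tree above  inject₁ i  joins it to its parent  par i.  Every rooted
-- tree admits such a numbering (parent index strictly larger than the
-- child index), which guarantees acyclicity.  Edges are thus indexed by
-- Fin v (edge i = {par i, inject₁ i}).

record EdgeLabeledTree (n c : ℕ) : Set where
  field
    v      : ℕ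
    par    : Fin v → Fin (suc v)
    par-up : ∀ i → toℕ i < toℕ (par i)
    -- For a non-root
    -- vertex, "no children" = degree 1 and "has a child" means inner;
    -- inner vertices (root included) must have at least two children,
    -- i.e. root degree ≥ 2 and non-root inner degree ≥ 3.
    branching : ∀ (u : Fin (suc v)) → (∃[ i ] par i ≡ u) →
                ∃[ i ] ∃[ j ] (i ≢ j × par i ≡ u × par j ≡ u)
    leaf      : Fin n → Fin (suc v)
    leaf-inj  : ∀ x y → leaf x ≡ leaf y → x ≡ y
    leaf-isLeaf : ∀ x (i : Fin v) → par i ≢ leaf x
    leaf-onto : ∀ (u : Fin (suc v)) → (∀ (i : Fin v) → par i ≢ u) →
                ∃[ x ] leaf x ≡ u
    lab    : Fin v → Subset c

module _ {n c : ℕ} (T : EdgeLabeledTree n c) where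
  open EdgeLabeledTree T

  data _⪯_ : Fin (suc v) → Fin (suc v) → Set where
    ⪯-refl : ∀ {a} → a ⪯ a
    ⪯-step : ∀ {b} (i : Fin v) → par i ⪯ b → inject₁ i ⪯ b

  IsLCA : Fin (suc v) → Fin (suc v) → Fin (suc v) → Set
  IsLCA u a b = a ⪯ u × b ⪯ u × (∀ w → a ⪯ w → b ⪯ w → u ⪯ w)

  OnPath : Fin (suc v) → Fin (suc v) → Fin v → Set
  OnPath u a i = a ⪯ inject₁ i × par i ⪯ u

  Explains : EpsMap n c → Set
  Explains ε = ∀ (x y : Fin n) (ne : x ≢ y) (m : Fin c) (u : Fin (suc v)) →
    IsLCA u (leaf x) (leaf y) →
    ((m ∈ ε x y ne) ⇔ (∃[ i ] (OnPath u (leaf y) i × m ∈ lab i)))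

  Restricted : ℕ → Set
  Restricted k = ∀ (i : Fin v) → ∣ lab i ∣ ≤ k

IsKFitch : ∀ {n c} → ℕ → EpsMap n c → Set
IsKFitch {n} {c} k ε =
  Σ (EdgeLabeledTree n c) λ T → Explains T ε × Restricted T k

module _ {n c : ℕ} (ε : EpsMap n c) where

  nbr : Fin c → Fin n → Subset n
  nbr m y = tabulate memb
    where
      memb : Fin n → Bool
      memb x with x ≟F y
      ... | yes _ = true
      ... | no ne = not (does (m ∈? ε x y ne))

  InNbr : Subset n → Set
  InNbr N = ∃[ y ] ∃[ m ] N ≡ nbr m y

  HierarchyLike : Set
  HierarchyLike = ∀ P Q → InNbr P → InNbr Q →
    (P ∩ Q ≡ P) ⊎ (P ∩ Q ≡ Q) ⊎ (P ∩ Q ≡ ⊥)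

  SizeCond : Set
  SizeCond = ∀ (y : Fin n) (m : Fin c) (y' : Fin n) →
    y' ∈ nbr m y → ∣ nbr m y' ∣ ≤ ∣ nbr m y ∣

  coloursOf : Subset n → Subset c
  coloursOf N = tabulate λ m → does (any? λ y → ≡-dec _≟B_ N (nbr m y))

  ColourCond : ℕ → Set
  ColourCond k = ∀ N → InNbr N → N ≢ ⊤ → ∣ coloursOf N ∣ ≤ k

module Submission where

-- In a tree explaining ε, N_m[y] is X if no m-edge lies above y, and otherwise the set of leaves
-- below the lowest m-edge above y.  Leaf sets of vertices form a hierarchy, whence (i) and (ii),
-- and distinct vertices have distinct leaf sets, so every colour m with N = N_m[y] labels the
-- edge above the vertex of N, whence (iii).
-- Conversely X, the singletons and the sets N_m[y] form a hierarchy by (i); its Hasse diagram is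
-- a phylogenetic tree, and we label the edge above N with the colours m such that N = N_m[y] for
-- some y, at most k of them by (iii).  By (i) and (ii), y ∈ N_m[y'] implies N_m[y] ⊆ N_m[y'],
-- which is exactly what is needed for this tree to explain ε.

open import Defs
open import Data.Nat using (ℕ; zero; suc; _≤_; _<_; z≤n; s≤s)
open import Data.Nat.Properties using (≤-refl; ≤-trans; ≤-antisym; <⇒≤; <⇒≱; <-cmp)
open import Data.Bool using (true)
open import Data.Bool.Properties using () renaming (_≟_ to _≟B_)
open import Data.Fin using (Fin; toℕ; inject₁; fromℕ)
  renaming (zero to fzero; suc to fsuc; _<_ to _<ᶠ_; _>_ to _>ᶠ_)
open import Data.Fin.Properties
  using (any?; toℕ-inject₁; toℕ-fromℕ; toℕ-injective; inject₁-injective; toℕ<n; fromℕ≢inject₁)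
  renaming (_≟_ to _≟F_)
open import Data.Fin.Induction using (<-wellFounded; >-wellFounded)
open import Data.Fin.Subset
  using (Subset; _∈_; _∉_; _⊆_; _⊂_; _⊉_; _∩_; ⊥; ⊤; ∣_∣; Nonempty; ⁅_⁆; inside; outside)
open import Data.Fin.Subset.Properties
  using ( _∈?_; _⊆?_; _⊂?_; ⊆-refl; ⊆-reflexive; ⊆-antisym; ⊆-trans; ⊆⊤; ∈⊤; ∉⊥
        ; p∩q⊆p; p∩q⊆q; x∈p∩q⁺; x∈p∩q⁻; p⊆q⇒∣p∣≤∣q∣; p⊂q⇒∣p∣<∣q∣; ⊂-irref
        ; Empty-unique; nonempty?; x∈⁅x⁆; x∈⁅y⁆⇒x≡y
        ; ∣⊥∣≡0; drop-∷-⊆)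
open import Data.Vec using ([]; _∷_; tabulate; lookup) renaming (here to vhere)
open import Data.Vec.Properties using (≡-dec; lookup∘tabulate; []=⇒lookup; lookup⇒[]=)
open import Data.List as List using (List; []; _∷_; _++_; filter; length)
open import Data.List.Membership.Propositional using () renaming (_∈_ to _∈ₗ_)
open import Data.List.Membership.Propositional.Properties
  using (∈-filter⁺; ∈-filter⁻; ∈-map⁺; ∈-++⁺ˡ; ∈-++⁺ʳ; ∈-lookup)
open import Data.List.Relation.Unary.All as All using (All)
import Data.List.Relation.Unary.All.Properties as All
open import Data.List.Relation.Unary.AllPairs as AllPairs using (AllPairs; []; _∷_)
import Data.List.Relation.Unary.AllPairs.Properties as AllPairs
open import Data.List.Relation.Unary.Any using (here; index)
open import Data.List.Relation.Unary.Any.Properties using (lookup-index)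
open import Data.Empty using (⊥-elim)
open import Data.Product using (∃; ∃-syntax; _×_; _,_; proj₁; proj₂)
open import Data.Sum using (_⊎_; inj₁; inj₂; [_,_]′)
open import Function using (_∘_; id)
open import Function.Bundles using (_⇔_; mk⇔; Equivalence)
open import Function.Properties.Equivalence using () renaming (trans to ⇔-trans; sym to ⇔-sym)
open import Induction.WellFounded using (Acc; acc)
open import Relation.Binary using (DecidableEquality)
open import Relation.Binary.PropositionalEquality using (_≡_; _≢_; refl; sym; trans; cong; subst)
open import Relation.Binary.Definitions using (tri<; tri≈; tri>)
open import Relation.Nullary using (¬_; Dec; yes; no; does; contradiction)
open import Relation.Nullary.Decidable using (decidable-stable; dec-true; dec-false; map′; _×-dec_; _⊎-dec_; ¬?)
open import Relation.Unary using (Decidable)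

open Equivalence using (to; from)

module _ {n : ℕ} where

  infix 4 _≟ˢ_

  _≟ˢ_ : DecidableEquality (Subset n)
  _≟ˢ_ = ≡-dec _≟B_

  ∈-tabulate-does⇔ : {P : Fin n → Set} (P? : ∀ x → Dec (P x)) {x : Fin n} →
                     x ∈ tabulate (λ x → does (P? x)) ⇔ P x
  ∈-tabulate-does⇔ P? {x} = mk⇔
    (λ x∈ → decidable-stable (P? x) λ ¬Px →
      contradiction (trans (sym (lookup-does x∈)) (dec-false (P? x) ¬Px)) λ ())
    (λ Px → lookup⇒[]= x _ (trans (lookup∘tabulate (λ x → does (P? x)) x) (dec-true (P? x) Px)))
    where
      lookup-does : x ∈ tabulate (λ x → does (P? x)) → does (P? x) ≡ true
      lookup-does x∈ = trans (sym (lookup∘tabulate (λ x → does (P? x)) x)) ([]=⇒lookup x∈)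

  p⊆q⇒p∩q≡p : {p q : Subset n} → p ⊆ q → p ∩ q ≡ p
  p⊆q⇒p∩q≡p {p} {q} p⊆q = ⊆-antisym (p∩q⊆p p q) (λ x∈p → x∈p∩q⁺ (x∈p , p⊆q x∈p))

  q⊆p⇒p∩q≡q : {p q : Subset n} → q ⊆ p → p ∩ q ≡ q
  q⊆p⇒p∩q≡q {p} {q} q⊆p = ⊆-antisym (p∩q⊆q p q) (λ x∈q → x∈p∩q⁺ (q⊆p x∈q , x∈q))

  p⊆q∧p≢q⇒p⊂q : {p q : Subset n} → p ⊆ q → p ≢ q → p ⊂ q
  p⊆q∧p≢q⇒p⊂q {p} {q} p⊆q p≢q with any? (λ x → x ∈? q ×-dec ¬? (x ∈? p))
  ... | yes (x , x∈q , x∉p) = p⊆q , x , x∈q , x∉p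
  ... | no ∄ = contradiction (⊆-antisym p⊆q q⊆p) p≢q
    where
      q⊆p : q ⊆ p
      q⊆p {x} x∈q = decidable-stable (x ∈? p) (λ x∉p → ∄ (x , x∈q , x∉p))

  p⊆q⇒∣q∣≤∣p∣⇒p≡q : {p q : Subset n} → p ⊆ q → ∣ q ∣ ≤ ∣ p ∣ → p ≡ q
  p⊆q⇒∣q∣≤∣p∣⇒p≡q {p} {q} p⊆q ∣q∣≤∣p∣ = decidable-stable (p ≟ˢ q) λ p≢q →
    <⇒≱ (p⊂q⇒∣p∣<∣q∣ (p⊆q∧p≢q⇒p⊂q p⊆q p≢q)) ∣q∣≤∣p∣

  x∈p⇒⁅x⁆⊆p : {x : Fin n} {p : Subset n} → x ∈ p → ⁅ x ⁆ ⊆ p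
  x∈p⇒⁅x⁆⊆p {x} {p} x∈p y∈⁅x⁆ = subst (_∈ p) (sym (x∈⁅y⁆⇒x≡y x y∈⁅x⁆)) x∈p

  nonempty⇒⊄⁅x⁆ : {p : Subset n} {x : Fin n} → Nonempty p → ¬ (p ⊂ ⁅ x ⁆)
  nonempty⇒⊄⁅x⁆ {p} {x} (z , z∈p) (p⊆⁅x⁆ , y , y∈⁅x⁆ , y∉p) =
    y∉p (subst (_∈ p) (trans (x∈⁅y⁆⇒x≡y x (p⊆⁅x⁆ z∈p)) (sym (x∈⁅y⁆⇒x≡y x y∈⁅x⁆)))
                     z∈p)

  Nested : Subset n → Subset n → Set
  Nested P Q = ∀ {x} → x ∈ P → x ∈ Q → P ⊆ Q ⊎ Q ⊆ P

  ∩-Trichotomy : Subset n → Subset n → Set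
  ∩-Trichotomy P Q = P ∩ Q ≡ P ⊎ P ∩ Q ≡ Q ⊎ P ∩ Q ≡ ⊥

  nested⇒∩-trichotomy : {P Q : Subset n} → Nested P Q → ∩-Trichotomy P Q
  nested⇒∩-trichotomy {P} {Q} nested with nonempty? (P ∩ Q)
  ... | no empty = inj₂ (inj₂ (Empty-unique empty))
  ... | yes (x , x∈P∩Q) with x∈p∩q⁻ P Q x∈P∩Q
  ...   | x∈P , x∈Q = [ inj₁ ∘ p⊆q⇒p∩q≡p , inj₂ ∘ inj₁ ∘ q⊆p⇒p∩q≡q ]′ (nested x∈P x∈Q)

  ∩-trichotomy⇒nested : {P Q : Subset n} → ∩-Trichotomy P Q → Nested P Q
  ∩-trichotomy⇒nested {P} {Q} (inj₁ P∩Q≡P) _ _ =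
    inj₁ (λ x∈P → proj₂ (x∈p∩q⁻ P Q (subst (_ ∈_) (sym P∩Q≡P) x∈P)))
  ∩-trichotomy⇒nested {P} {Q} (inj₂ (inj₁ P∩Q≡Q)) _ _ =
    inj₂ (λ x∈Q → proj₁ (x∈p∩q⁻ P Q (subst (_ ∈_) (sym P∩Q≡Q) x∈Q)))
  ∩-trichotomy⇒nested (inj₂ (inj₂ P∩Q≡⊥)) x∈P x∈Q =
    contradiction (subst (_ ∈_) P∩Q≡⊥ (x∈p∩q⁺ (x∈P , x∈Q))) ∉⊥

  nested-sym : {P Q : Subset n} → Nested P Q → Nested Q P
  nested-sym nested x∈Q x∈P = [ inj₂ , inj₁ ]′ (nested x∈P x∈Q)

  ⊤-nested : {Q : Subset n} → Nested ⊤ Q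
  ⊤-nested _ _ = inj₂ ⊆⊤

  ⁅⁆-nested : {x : Fin n} {Q : Subset n} → Nested ⁅ x ⁆ Q
  ⁅⁆-nested {x} {Q} y∈⁅x⁆ y∈Q =
    inj₁ (x∈p⇒⁅x⁆⊆p (subst (_∈ Q) (x∈⁅y⁆⇒x≡y x y∈⁅x⁆) y∈Q))

module Neighbourhoods {n c : ℕ} (ε : EpsMap n c) where

  private
    -- The right-hand side is the local membership function of nbr, which has no name outside Defs.
    lookup-nbr : ∀ m x y → lookup (nbr ε m y) x ≡ _
    lookup-nbr m x y = lookup∘tabulate _ x

    lookup-nbr⇔ : ∀ m x y → lookup (nbr ε m y) x ≡ true ⇔ (∀ (x≢y : x ≢ y) → m ∉ ε x y x≢y)
    lookup-nbr⇔ m x y rewrite lookup-nbr m x y with x ≟F y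
    ... | yes x≡y = mk⇔ (λ _ x≢y → contradiction x≡y x≢y) (λ _ → refl)
    ... | no x≢y with m ∈? ε x y x≢y
    ...   | yes m∈ε = mk⇔ (λ ()) (λ m∉ε → contradiction m∈ε (m∉ε x≢y))
    ...   | no m∉ε = mk⇔ (λ _ _ → m∉ε) (λ _ → refl)

  ∈-nbr⇔ : ∀ {m x y} → x ∈ nbr ε m y ⇔ (∀ (x≢y : x ≢ y) → m ∉ ε x y x≢y)
  ∈-nbr⇔ {m} {x} {y} = mk⇔
    (to (lookup-nbr⇔ m x y) ∘ []=⇒lookup)
    (lookup⇒[]= x _ ∘ from (lookup-nbr⇔ m x y))

  y∈nbr : ∀ m y → y ∈ nbr ε m y
  y∈nbr m y = from ∈-nbr⇔ λ y≢y → contradiction refl y≢y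

  ∈-coloursOf⇔ : ∀ {N m} → m ∈ coloursOf ε N ⇔ (∃[ y ] N ≡ nbr ε m y)
  ∈-coloursOf⇔ {N} = ∈-tabulate-does⇔ (λ m → any? λ y → N ≟ˢ nbr ε m y)

data FromℕOrInject₁ (v : ℕ) : Fin (suc v) → Set where
  fromℕ-view   : FromℕOrInject₁ v (fromℕ v)
  inject₁-view : (i : Fin v) → FromℕOrInject₁ v (inject₁ i)

fromℕ-or-inject₁ : ∀ {v} (u : Fin (suc v)) → FromℕOrInject₁ v u
fromℕ-or-inject₁ {zero} fzero = fromℕ-view
fromℕ-or-inject₁ {suc v} fzero = inject₁-view fzero
fromℕ-or-inject₁ {suc v} (fsuc u) with fromℕ-or-inject₁ u
... | fromℕ-view = fromℕ-view
... | inject₁-view i = inject₁-view (fsuc i)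

fromℕ-or-inject₁-fromℕ : ∀ v → fromℕ-or-inject₁ (fromℕ v) ≡ fromℕ-view
fromℕ-or-inject₁-fromℕ zero = refl
fromℕ-or-inject₁-fromℕ (suc v) rewrite fromℕ-or-inject₁-fromℕ v = refl

fromℕ-or-inject₁-inject₁ : ∀ {v} (i : Fin v) → fromℕ-or-inject₁ (inject₁ i) ≡ inject₁-view i
fromℕ-or-inject₁-inject₁ {suc v} fzero = refl
fromℕ-or-inject₁-inject₁ {suc v} (fsuc i) rewrite fromℕ-or-inject₁-inject₁ i = refl

-- Only the parent function of a tree is assumed, so that this also applies to a tree under construction.
module Ancestry {v : ℕ} (par : Fin v → Fin (suc v)) (par-up : ∀ i → toℕ i < toℕ (par i)) where

  infix 4 _≼_ _≼?_

  data _≼_ : Fin (suc v) → Fin (suc v) → Set where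
    ≼-refl : ∀ {a} → a ≼ a
    ≼-step : ∀ {b} i → par i ≼ b → inject₁ i ≼ b

  root : Fin (suc v)
  root = fromℕ v

  inject₁<par : ∀ i → inject₁ i <ᶠ par i
  inject₁<par i = subst (_< toℕ (par i)) (sym (toℕ-inject₁ i)) (par-up i)

  ≼⇒toℕ≤ : ∀ {a b} → a ≼ b → toℕ a ≤ toℕ b
  ≼⇒toℕ≤ ≼-refl = ≤-refl
  ≼⇒toℕ≤ (≼-step i p) = ≤-trans (<⇒≤ (inject₁<par i)) (≼⇒toℕ≤ p)

  ≼-antisym : ∀ {a b} → a ≼ b → b ≼ a → a ≡ b
  ≼-antisym a≼b b≼a = toℕ-injective (≤-antisym (≼⇒toℕ≤ a≼b) (≼⇒toℕ≤ b≼a))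

  ≼-trans : ∀ {a b d} → a ≼ b → b ≼ d → a ≼ d
  ≼-trans ≼-refl b≼d = b≼d
  ≼-trans (≼-step i p) b≼d = ≼-step i (≼-trans p b≼d)

  par⋠inject₁ : ∀ i → ¬ (par i ≼ inject₁ i)
  par⋠inject₁ i p = <⇒≱ (inject₁<par i) (≼⇒toℕ≤ p)

  ≼-inject₁⁻ : ∀ {i b} → inject₁ i ≼ b → inject₁ i ≡ b ⊎ par i ≼ b
  ≼-inject₁⁻ = go refl
    where
      go : ∀ {a i b} → a ≡ inject₁ i → a ≼ b → inject₁ i ≡ b ⊎ par i ≼ b
      go a≡i ≼-refl = inj₁ (sym a≡i)
      go a≡i (≼-step j p) with inject₁-injective a≡i
      ... | refl = inj₂ p

  ≼∧≢⇒par≼ : ∀ {i b} → inject₁ i ≼ b → inject₁ i ≢ b → par i ≼ b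
  ≼∧≢⇒par≼ i≼b i≢b = [ (λ i≡b → contradiction i≡b i≢b) , id ]′ (≼-inject₁⁻ i≼b)

  upward-induction : (P : Fin (suc v) → Set) → P root → (∀ i → P (par i) → P (inject₁ i)) → ∀ u → P u
  upward-induction P P-root P-step u = go u (>-wellFounded u)
    where
      go : ∀ u → Acc _>ᶠ_ u → P u
      go u (acc rec) with fromℕ-or-inject₁ u
      ... | fromℕ-view = P-root
      ... | inject₁-view i = P-step i (go (par i) (rec (inject₁<par i)))

  ≼-root : ∀ u → u ≼ root
  ≼-root = upward-induction (_≼ root) ≼-refl ≼-step

  root-maximal : ∀ {b} → root ≼ b → b ≡ root
  root-maximal root≼b = ≼-antisym (≼-root _) root≼b

  _≼?_ : ∀ a b → Dec (a ≼ b)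
  a ≼? b = upward-induction (λ a → Dec (a ≼ b)) root≼? inject₁≼? a
    where
      root≼? : Dec (root ≼ b)
      root≼? = map′ (λ { refl → ≼-refl }) (sym ∘ root-maximal) (root ≟F b)
      inject₁≼? : ∀ i → Dec (par i ≼ b) → Dec (inject₁ i ≼ b)
      inject₁≼? i par≼? =
        map′ [ (λ { refl → ≼-refl }) , ≼-step i ]′ ≼-inject₁⁻ (inject₁ i ≟F b ⊎-dec par≼?)

  ≼-linear : ∀ {a b d} → a ≼ b → a ≼ d → b ≼ d ⊎ d ≼ b
  ≼-linear ≼-refl a≼d = inj₁ a≼d
  ≼-linear (≼-step i p) i≼d with ≼-inject₁⁻ i≼d
  ... | inj₁ refl = inj₂ (≼-step i p)
  ... | inj₂ q = ≼-linear p q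

  ≼-child : ∀ {a u} → a ≼ u → a ≢ u → ∃[ i ] (par i ≡ u × a ≼ inject₁ i)
  ≼-child ≼-refl a≢a = contradiction refl a≢a
  ≼-child {u = u} (≼-step i p) _ with par i ≟F u
  ... | yes par≡u = i , par≡u , ≼-refl
  ... | no par≢u = let j , par≡u , q = ≼-child p par≢u in j , par≡u , ≼-step i q

  siblings-comparable : ∀ {i j} → par i ≡ par j →
                        inject₁ i ≼ inject₁ j ⊎ inject₁ j ≼ inject₁ i → i ≡ j
  siblings-comparable par≡par (inj₁ i≼j) = sibling-≼ par≡par i≼j
    where
      sibling-≼ : ∀ {i j} → par i ≡ par j → inject₁ i ≼ inject₁ j → i ≡ j
      sibling-≼ {i} {j} par≡par i≼j with ≼-inject₁⁻ i≼j
      ... | inj₁ i≡j = inject₁-injective i≡j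
      ... | inj₂ par≼j = contradiction (subst (_≼ inject₁ j) par≡par par≼j) (par⋠inject₁ j)
  siblings-comparable par≡par (inj₂ j≼i) = sym (siblings-comparable (sym par≡par) (inj₁ j≼i))

  IsLca : Fin (suc v) → Fin (suc v) → Fin (suc v) → Set
  IsLca u a b = a ≼ u × b ≼ u × (∀ w → a ≼ w → b ≼ w → u ≼ w)

  lca : ∀ a b → ∃[ u ] IsLca u a b
  lca a b = upward-induction (λ a → ∃[ u ] IsLca u a b)
              (root , ≼-refl , ≼-root b , λ _ root≼w _ → root≼w) step a
    where
      step : ∀ i → ∃[ u ] IsLca u (par i) b → ∃[ u ] IsLca u (inject₁ i) b
      step i (u , par≼u , b≼u , least) with b ≼? inject₁ i
      ... | yes b≼i = inject₁ i , ≼-refl , b≼i , λ _ i≼w _ → i≼w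
      ... | no b⋠i = u , ≼-step i par≼u , b≼u , least′
        where
          least′ : ∀ w → inject₁ i ≼ w → b ≼ w → u ≼ w
          least′ w i≼w b≼w with ≼-inject₁⁻ i≼w
          ... | inj₁ refl = contradiction b≼w b⋠i
          ... | inj₂ par≼w = least w par≼w b≼w

module TreeAncestry {n c : ℕ} (T : EdgeLabeledTree n c) where
  open EdgeLabeledTree T public
  open Ancestry par par-up public

  ⪯⇒≼ : ∀ {a b} → _⪯_ T a b → a ≼ b
  ⪯⇒≼ ⪯-refl = ≼-refl
  ⪯⇒≼ (⪯-step i p) = ≼-step i (⪯⇒≼ p)

  ≼⇒⪯ : ∀ {a b} → a ≼ b → _⪯_ T a b
  ≼⇒⪯ ≼-refl = ⪯-refl
  ≼⇒⪯ (≼-step i p) = ⪯-step i (≼⇒⪯ p)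

  isLCA⇔isLca : ∀ {u a b} → IsLCA T u a b ⇔ IsLca u a b
  isLCA⇔isLca = mk⇔
    (λ (a⪯u , b⪯u , least) → ⪯⇒≼ a⪯u , ⪯⇒≼ b⪯u ,
       λ w a≼w b≼w → ⪯⇒≼ (least w (≼⇒⪯ a≼w) (≼⇒⪯ b≼w)))
    (λ (a≼u , b≼u , least) → ≼⇒⪯ a≼u , ≼⇒⪯ b≼u ,
       λ w a⪯w b⪯w → ≼⇒⪯ (least w (⪯⇒≼ a⪯w) (⪯⇒≼ b⪯w)))

  EdgeBelow : Fin (suc v) → Fin (suc v) → Fin c → Set
  EdgeBelow u a m = ∃[ i ] ((a ≼ inject₁ i × par i ≼ u) × m ∈ lab i)

  edgeOnPath⇔edgeBelow : ∀ {u a m} → (∃[ i ] (OnPath T u a i × m ∈ lab i)) ⇔ EdgeBelow u a m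
  edgeOnPath⇔edgeBelow = mk⇔
    (λ (i , (a⪯i , par⪯u) , m∈i) → i , (⪯⇒≼ a⪯i , ⪯⇒≼ par⪯u) , m∈i)
    (λ (i , (a≼i , par≼u) , m∈i) → i , (≼⇒⪯ a≼i , ≼⇒⪯ par≼u) , m∈i)

  Explains≼ : EpsMap n c → Set
  Explains≼ ε = ∀ x y (x≢y : x ≢ y) m u → IsLca u (leaf x) (leaf y) →
                (m ∈ ε x y x≢y ⇔ EdgeBelow u (leaf y) m)

  explains⇔explains≼ : ∀ {ε} → Explains T ε ⇔ Explains≼ ε
  explains⇔explains≼ = mk⇔
    (λ explains x y x≢y m u isLca →
      ⇔-trans (explains x y x≢y m u (from isLCA⇔isLca isLca)) edgeOnPath⇔edgeBelow)
    (λ explains x y x≢y m u isLCA →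
      ⇔-trans (explains x y x≢y m u (to isLCA⇔isLca isLCA)) (⇔-sym edgeOnPath⇔edgeBelow))

module Clusters {n c : ℕ} (T : EdgeLabeledTree n c) where
  open TreeAncestry T

  leaf-below : ∀ u → ∃[ x ] leaf x ≼ u
  leaf-below u = go u (<-wellFounded u)
    where
      go : ∀ u → Acc _<ᶠ_ u → ∃[ x ] leaf x ≼ u
      go u (acc rec) with any? (λ i → par i ≟F u)
      ... | yes (i , refl) =
        let x , x≼i = go (inject₁ i) (rec (inject₁<par i)) in x , ≼-trans x≼i (≼-step i ≼-refl)
      ... | no childless =
        let x , leaf≡u = leaf-onto u (λ i par≡u → childless (i , par≡u)) in x , subst (leaf x ≼_) leaf≡u ≼-refl

  cluster : Fin (suc v) → Subset n
  cluster u = tabulate (λ x → does (leaf x ≼? u))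

  ∈-cluster⇔ : ∀ {x u} → x ∈ cluster u ⇔ leaf x ≼ u
  ∈-cluster⇔ {u = u} = ∈-tabulate-does⇔ (λ x → leaf x ≼? u)

  cluster-mono : ∀ {u w} → u ≼ w → cluster u ⊆ cluster w
  cluster-mono u≼w x∈u = from ∈-cluster⇔ (≼-trans (to ∈-cluster⇔ x∈u) u≼w)

  cluster-nested : ∀ u w → Nested (cluster u) (cluster w)
  cluster-nested u w x∈u x∈w = [ inj₁ ∘ cluster-mono , inj₂ ∘ cluster-mono ]′
    (≼-linear (to ∈-cluster⇔ x∈u) (to ∈-cluster⇔ x∈w))

  other-child : ∀ {w i} → par i ≡ w → ∃[ k ] (par k ≡ w × k ≢ i)
  other-child {w} {i} par-i≡w with branching w (i , par-i≡w)
  ... | j , j′ , j≢j′ , par-j≡w , par-j′≡w with j ≟F i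
  ...   | yes refl = j′ , par-j′≡w , j≢j′ ∘ sym
  ...   | no j≢i = j , par-j≡w , j≢i

  -- A leaf below a child of w other than the one above u lies in cluster w but not in cluster u.
  cluster-strict : ∀ {u w} → u ≼ w → u ≢ w → ¬ (cluster w ⊆ cluster u)
  cluster-strict {u} {w} u≼w u≢w w⊆u =
    let i , par-i≡w , u≼i = ≼-child u≼w u≢w
        k , par-k≡w , k≢i = other-child par-i≡w
        z , z≼k = leaf-below (inject₁ k)
        z≼w = ≼-trans z≼k (subst (inject₁ k ≼_) par-k≡w (≼-step k ≼-refl))
        z≼i = ≼-trans (to ∈-cluster⇔ (w⊆u (from ∈-cluster⇔ z≼w))) u≼i
    in k≢i (siblings-comparable (trans par-k≡w (sym par-i≡w)) (≼-linear z≼k z≼i))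

  cluster-injective : ∀ {u w} → cluster u ≡ cluster w → u ≡ w
  cluster-injective {u} {w} cu≡cw with leaf-below u
  ... | x , x≼u with ≼-linear x≼u (to ∈-cluster⇔ (subst (x ∈_) cu≡cw (from ∈-cluster⇔ x≼u)))
  ...   | inj₁ u≼w = decidable-stable (u ≟F w) λ u≢w →
            cluster-strict u≼w u≢w (⊆-reflexive (sym cu≡cw))
  ...   | inj₂ w≼u = decidable-stable (u ≟F w) λ u≢w →
            cluster-strict w≼u (u≢w ∘ sym) (⊆-reflexive cu≡cw)

module FitchMap⇒Conditions {k n c : ℕ} (ε : EpsMap n c) (T : EdgeLabeledTree n c)
                          (explains : Explains T ε) (restricted : Restricted T k) where
  open TreeAncestry T
  open Clusters T
  open Neighbourhoods ε

  explains≼ : Explains≼ ε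
  explains≼ = to explains⇔explains≼ explains

  data FirstEdge (a : Fin (suc v)) (m : Fin c) : Set where
    none  : (∀ i → a ≼ inject₁ i → m ∉ lab i) → FirstEdge a m
    first : ∀ i → a ≼ inject₁ i → m ∈ lab i →
            (∀ j → a ≼ inject₁ j → m ∈ lab j → inject₁ i ≼ inject₁ j) → FirstEdge a m

  first-edge : ∀ a m → FirstEdge a m
  first-edge a m = upward-induction (λ a → FirstEdge a m) (none root-unlabelled) step a
    where
      root-unlabelled : ∀ i → root ≼ inject₁ i → m ∉ lab i
      root-unlabelled i root≼i _ = fromℕ≢inject₁ (sym (root-maximal root≼i))
      skip-unlabelled : ∀ {i j} → m ∉ lab i → inject₁ i ≼ inject₁ j → m ∈ lab j → par i ≼ inject₁ j
      skip-unlabelled m∉i i≼j m∈j with ≼-inject₁⁻ i≼j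
      ... | inj₁ i≡j = ⊥-elim (m∉i (subst (λ j → m ∈ lab j) (sym (inject₁-injective i≡j)) m∈j))
      ... | inj₂ par≼j = par≼j
      step : ∀ i → FirstEdge (par i) m → FirstEdge (inject₁ i) m
      step i above with m ∈? lab i
      ... | yes m∈i = first i ≼-refl m∈i λ _ i≼j _ → i≼j
      ... | no m∉i with above
      ...   | none unlabelled = none λ j i≼j m∈j → unlabelled j (skip-unlabelled m∉i i≼j m∈j) m∈j
      ...   | first j par≼j m∈j lowest =
        first j (≼-step i par≼j) m∈j λ j′ i≼j′ m∈j′ → lowest j′ (skip-unlabelled m∉i i≼j′ m∈j′) m∈j′

  nbr≡⊤ : ∀ {m y} → (∀ i → leaf y ≼ inject₁ i → m ∉ lab i) → nbr ε m y ≡ ⊤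
  nbr≡⊤ {m} {y} unlabelled = ⊆-antisym ⊆⊤ λ {x} _ → from ∈-nbr⇔ λ x≢y m∈ε →
    let u , isLca = lca (leaf x) (leaf y)
        i , (y≼i , _) , m∈i = to (explains≼ x y x≢y m u isLca) m∈ε
    in unlabelled i y≼i m∈i

  -- If x were outside the cluster, the lca of x and y would lie above edge i, forcing m ∈ ε x y.
  nbr⊆cluster : ∀ {m y i} → leaf y ≼ inject₁ i → m ∈ lab i → nbr ε m y ⊆ cluster (inject₁ i)
  nbr⊆cluster {m} {y} {i} y≼i m∈i {x} x∈nbr =
    from ∈-cluster⇔ (decidable-stable (leaf x ≼? inject₁ i) λ x⋠i →
      let x≢y = λ { refl → x⋠i y≼i }
          u , isLca@(x≼u , y≼u , _) = lca (leaf x) (leaf y)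
      in [ (λ u≼i → x⋠i (≼-trans x≼u u≼i))
         , (λ i≼u → to ∈-nbr⇔ x∈nbr x≢y (from (explains≼ x y x≢y m u isLca)
             (i , (y≼i , ≼∧≢⇒par≼ i≼u λ i≡u → x⋠i (subst (leaf x ≼_) (sym i≡u) x≼u)) , m∈i)))
         ]′ (≼-linear y≼u y≼i))

  cluster⊆nbr : ∀ {m y i} → leaf y ≼ inject₁ i → m ∈ lab i →
                (∀ j → leaf y ≼ inject₁ j → m ∈ lab j → inject₁ i ≼ inject₁ j) →
                cluster (inject₁ i) ⊆ nbr ε m y
  cluster⊆nbr {m} {y} {i} y≼i m∈i lowest {x} x∈cluster = from ∈-nbr⇔ λ x≢y m∈ε →
    let u , isLca@(_ , _ , least) = lca (leaf x) (leaf y)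
        j , (y≼j , par≼u) , m∈j = to (explains≼ x y x≢y m u isLca)  m∈ε
        u≼i = least (inject₁ i) (to ∈-cluster⇔ x∈cluster) y≼i
    in par⋠inject₁ j (≼-trans par≼u (≼-trans u≼i (lowest j y≼j m∈j)))

  nbr-cases : ∀ m y → nbr ε m y ≡ ⊤ ⊎ ∃[ i ] (nbr ε m y ≡ cluster (inject₁ i) × m ∈ lab i)
  nbr-cases m y with first-edge (leaf y) m
  ... | none unlabelled = inj₁ (nbr≡⊤ unlabelled)
  ... | first i y≼i m∈i lowest =
    inj₂ (i , ⊆-antisym (nbr⊆cluster y≼i m∈i) (cluster⊆nbr y≼i m∈i lowest) , m∈i)

  ⊤-or-cluster : ∀ {N} → InNbr ε N → N ≡ ⊤ ⊎ ∃[ u ] N ≡ cluster u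
  ⊤-or-cluster (y , m , N≡nbr) with nbr-cases m y
  ... | inj₁ nbr≡⊤ = inj₁ (trans N≡nbr nbr≡⊤)
  ... | inj₂ (i , nbr≡cluster , _) = inj₂ (inject₁ i , trans N≡nbr nbr≡cluster)

  hierarchyLike : HierarchyLike ε
  hierarchyLike P Q P∈𝒩 Q∈𝒩 = nested⇒∩-trichotomy (nested (⊤-or-cluster P∈𝒩) (⊤-or-cluster Q∈𝒩))
    where
      nested : ∀ {P Q} → P ≡ ⊤ ⊎ ∃[ u ] P ≡ cluster u → Q ≡ ⊤ ⊎ ∃[ w ] Q ≡ cluster w →
               Nested P Q
      nested (inj₁ refl) _ = ⊤-nested
      nested (inj₂ _) (inj₁ refl) = nested-sym ⊤-nested
      nested (inj₂ (u , refl)) (inj₂ (w , refl)) = cluster-nested u w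

  sizeCond : SizeCond ε
  sizeCond y m y′ y′∈nbr with nbr-cases m y
  ... | inj₁ nbr≡⊤ =
    subst (λ N → ∣ nbr ε m y′ ∣ ≤ ∣ N ∣) (sym nbr≡⊤) (p⊆q⇒∣p∣≤∣q∣ {p = nbr ε m y′} ⊆⊤)
  ... | inj₂ (i , nbr≡cluster , m∈i) =
    subst (λ N → ∣ nbr ε m y′ ∣ ≤ ∣ N ∣) (sym nbr≡cluster)
      (p⊆q⇒∣p∣≤∣q∣ (nbr⊆cluster (to ∈-cluster⇔ (subst (y′ ∈_) nbr≡cluster y′∈nbr)) m∈i))

  colourCond : ColourCond ε k
  colourCond N (y , m , N≡nbr) N≢⊤ with nbr-cases m y
  ... | inj₁ nbr≡⊤ = contradiction (trans N≡nbr nbr≡⊤) N≢⊤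
  ... | inj₂ (i , nbr≡cluster , _) = ≤-trans (p⊆q⇒∣p∣≤∣q∣ colours⊆lab) (restricted i)
    where
      colours⊆lab : coloursOf ε N ⊆ lab i
      colours⊆lab {m′} m′∈colours with to ∈-coloursOf⇔ m′∈colours
      ... | y′ , N≡nbr′ with nbr-cases m′ y′
      ...   | inj₁ nbr′≡⊤ = contradiction (trans N≡nbr′ nbr′≡⊤) N≢⊤
      ...   | inj₂ (j , nbr′≡cluster , m′∈j) =
        subst (λ j → m′ ∈ lab j)
          (inject₁-injective (cluster-injective
            (trans (sym nbr′≡cluster) (trans (sym N≡nbr′) (trans N≡nbr nbr≡cluster)))))
          m′∈j

-- Listing outside-subsets before inside-subsets at every position is a linear extension of ⊆.
allSubsets : ∀ n → List (Subset n)
allSubsets zero = [] ∷ []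
allSubsets (suc n) = List.map (outside ∷_) (allSubsets n) ++ List.map (inside ∷_) (allSubsets n)

∈-allSubsets : ∀ {n} (p : Subset n) → p ∈ₗ allSubsets n
∈-allSubsets [] = here refl
∈-allSubsets (outside ∷ p) = ∈-++⁺ˡ (∈-map⁺ (outside ∷_) (∈-allSubsets p))
∈-allSubsets (inside ∷ p) = ∈-++⁺ʳ _ (∈-map⁺ (inside ∷_) (∈-allSubsets p))

allSubsets-sorted : ∀ n → AllPairs _⊉_ (allSubsets n)
allSubsets-sorted zero = All.[] ∷ []
allSubsets-sorted (suc n) = AllPairs.++⁺
  (AllPairs.map⁺ (AllPairs.map (_∘ drop-∷-⊆) (allSubsets-sorted n)))
  (AllPairs.map⁺ (AllPairs.map (_∘ drop-∷-⊆) (allSubsets-sorted n)))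
  (All.map⁺ (All.universal (λ _ → All.map⁺ (All.universal (λ _ in⊆out → outside∌0 (in⊆out vhere)) _)) _))
  where
    outside∌0 : ∀ {p : Subset n} → ¬ (fzero ∈ outside ∷ p)
    outside∌0 ()

AllPairs-lookup : ∀ {A : Set} {R : A → A → Set} {xs : List A} → AllPairs R xs →
                  ∀ {i j} → toℕ i < toℕ j → R (List.lookup xs i) (List.lookup xs j)
AllPairs-lookup (Rx ∷ _) {fzero} {fsuc j} _ = All.lookup Rx (∈-lookup j)
AllPairs-lookup (_ ∷ Rxs) {fsuc i} {fsuc j} (s≤s i<j) = AllPairs-lookup Rxs i<j

least? : ∀ {m} {P : Fin m → Set} → (∀ j → Dec (P j)) →
         (∃[ j ] (P j × ∀ {j′} → P j′ → toℕ j ≤ toℕ j′)) ⊎ (∀ j → ¬ P j)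
least? {zero} P? = inj₂ λ ()
least? {suc m} P? with P? fzero
... | yes P0 = inj₁ (fzero , P0 , λ _ → z≤n)
... | no ¬P0 with least? (λ j → P? (fsuc j))
...   | inj₁ (j , Pj , least) =
  inj₁ (fsuc j , Pj , λ { {fzero} P0 → contradiction P0 ¬P0 ; {fsuc j′} Pj′ → s≤s (least Pj′) })
...   | inj₂ none = inj₂ λ { fzero → ¬P0 ; (fsuc j) → none j }

-- The tree whose vertices are the members of a hierarchy H (⊤ the root, singletons the leaves),
-- each member hanging below the smallest member strictly containing it.
module HierarchyTree {N c : ℕ} (H : Subset N → Set) (H? : Decidable H)
                     (H-⊤ : H ⊤) (H-⁅⁆ : ∀ x → H ⁅ x ⁆) (H-nonempty : ∀ {S} → H S → Nonempty S)
                     (H-nested : ∀ {P Q} → H P → H Q → Nested P Q)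
                     (label : Subset N → Subset c) where

  Proper : Subset N → Set
  Proper S = H S × S ≢ ⊤

  proper? : Decidable Proper
  proper? S = H? S ×-dec ¬? (S ≟ˢ ⊤)

  properSets : List (Subset N)
  properSets = filter proper? (allSubsets N)

  v : ℕ
  v = length properSets

  setAt : Fin v → Subset N
  setAt = List.lookup properSets

  setAt-proper : ∀ i → Proper (setAt i)
  setAt-proper i = proj₂ (∈-filter⁻ proper? {xs = allSubsets N} (∈-lookup i))

  setAt-onto : ∀ {S} → Proper S → ∃[ i ] setAt i ≡ S
  setAt-onto {S} proper = index S∈ , sym (lookup-index S∈)
    where
      S∈ : S ∈ₗ properSets
      S∈ = ∈-filter⁺ proper? (∈-allSubsets S) proper

  setAt-sorted : ∀ {i j} → toℕ i < toℕ j → setAt i ⊉ setAt j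
  setAt-sorted = AllPairs-lookup (AllPairs.filter⁺ proper? (allSubsets-sorted N))

  setAt-injective : ∀ {i j} → setAt i ≡ setAt j → i ≡ j
  setAt-injective {i} {j} i≡j with <-cmp (toℕ i) (toℕ j)
  ... | tri< i<j _ _ = ⊥-elim (setAt-sorted i<j (⊆-reflexive (sym i≡j)))
  ... | tri≈ _ i≡j _ = toℕ-injective i≡j
  ... | tri> _ _ j<i = ⊥-elim (setAt-sorted j<i (⊆-reflexive i≡j))

  ⊂⇒toℕ< : ∀ {i j} → setAt i ⊂ setAt j → toℕ i < toℕ j
  ⊂⇒toℕ< {i} {j} i⊂j with <-cmp (toℕ i) (toℕ j)
  ... | tri< i<j _ _ = i<j
  ... | tri≈ _ i≡j _ = contradiction i⊂j (⊂-irref (cong setAt (toℕ-injective i≡j)))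
  ... | tri> _ _ j<i = ⊥-elim (setAt-sorted j<i (proj₁ i⊂j))

  H⇒⊤-or-setAt : ∀ {S} → H S → S ≡ ⊤ ⊎ ∃[ i ] setAt i ≡ S
  H⇒⊤-or-setAt {S} HS with S ≟ˢ ⊤
  ... | yes S≡⊤ = inj₁ S≡⊤
  ... | no S≢⊤ = inj₂ (setAt-onto (HS , S≢⊤))

  -- Strict supersets of a member are nested, and a strictly smaller one would be listed earlier.
  first-superset-least : ∀ {i j j′} → setAt i ⊂ setAt j → setAt i ⊂ setAt j′ →
                         toℕ j ≤ toℕ j′ → setAt j ⊆ setAt j′
  first-superset-least {i} {j} {j′} i⊂j i⊂j′ j≤j′ with H-nonempty (proj₁ (setAt-proper i))
  ... | x , x∈i with H-nested (proj₁ (setAt-proper j)) (proj₁ (setAt-proper j′))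
                              (proj₁ i⊂j x∈i) (proj₁ i⊂j′ x∈i)
  ...   | inj₁ j⊆j′ = j⊆j′
  ...   | inj₂ j′⊆j = decidable-stable (setAt j ⊆? setAt j′) λ j⊈j′ →
            <⇒≱ (⊂⇒toℕ< (p⊆q∧p≢q⇒p⊂q j′⊆j λ j′≡j → j⊈j′ (⊆-reflexive (sym j′≡j)))) j≤j′

  vertexSetOf : ∀ {u} → FromℕOrInject₁ v u → Subset N
  vertexSetOf fromℕ-view = ⊤
  vertexSetOf (inject₁-view i) = setAt i

  vertexSet : Fin (suc v) → Subset N
  vertexSet u = vertexSetOf (fromℕ-or-inject₁ u)

  vertexSet-fromℕ : vertexSet (fromℕ v) ≡ ⊤
  vertexSet-fromℕ = cong vertexSetOf (fromℕ-or-inject₁-fromℕ v)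

  vertexSet-inject₁ : ∀ i → vertexSet (inject₁ i) ≡ setAt i
  vertexSet-inject₁ i = cong vertexSetOf (fromℕ-or-inject₁-inject₁ i)

  vertexSet-H : ∀ u → H (vertexSet u)
  vertexSet-H u = vertexSetOf-H (fromℕ-or-inject₁ u)
    where
      vertexSetOf-H : ∀ {u} (view : FromℕOrInject₁ v u) → H (vertexSetOf view)
      vertexSetOf-H fromℕ-view = H-⊤
      vertexSetOf-H (inject₁-view i) = proj₁ (setAt-proper i)

  vertexSet-onto : ∀ {S} → H S → ∃[ u ] vertexSet u ≡ S
  vertexSet-onto HS with H⇒⊤-or-setAt HS
  ... | inj₁ S≡⊤ = fromℕ v , trans vertexSet-fromℕ (sym S≡⊤)
  ... | inj₂ (i , i≡S) = inject₁ i , trans (vertexSet-inject₁ i) i≡S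

  vertexSet-injective : ∀ {u w} → vertexSet u ≡ vertexSet w → u ≡ w
  vertexSet-injective {u} {w} = vertexSetOf-injective (fromℕ-or-inject₁ u) (fromℕ-or-inject₁ w)
    where
      vertexSetOf-injective : ∀ {u w} (a : FromℕOrInject₁ v u) (b : FromℕOrInject₁ v w) →
                              vertexSetOf a ≡ vertexSetOf b → u ≡ w
      vertexSetOf-injective fromℕ-view fromℕ-view _ = refl
      vertexSetOf-injective fromℕ-view (inject₁-view j) ⊤≡j = contradiction (sym ⊤≡j) (proj₂ (setAt-proper j))
      vertexSetOf-injective (inject₁-view i) fromℕ-view i≡⊤ = contradiction i≡⊤ (proj₂ (setAt-proper i))
      vertexSetOf-injective (inject₁-view i) (inject₁-view j) i≡j = cong inject₁ (setAt-injective i≡j)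

  record Parent (i : Fin v) : Set where
    field
      vertex   : Fin (suc v)
      above    : toℕ i < toℕ vertex
      ⊂-vertex : setAt i ⊂ vertexSet vertex
      least    : ∀ {W} → H W → setAt i ⊂ W → vertexSet vertex ⊆ W

  parent : ∀ i → Parent i
  parent i with least? (λ j → setAt i ⊂? setAt j)
  ... | inj₁ (j , i⊂j , j-first) = record
    { vertex = inject₁ j
    ; above = subst (toℕ i <_) (sym (toℕ-inject₁ j)) (⊂⇒toℕ< i⊂j)
    ; ⊂-vertex = subst (setAt i ⊂_) (sym (vertexSet-inject₁ j)) i⊂j
    ; least = λ {W} HW i⊂W → subst (_⊆ W) (sym (vertexSet-inject₁ j)) (j-least HW i⊂W)
    }
    where
      j-least : ∀ {W} → H W → setAt i ⊂ W → setAt j ⊆ W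
      j-least HW i⊂W with H⇒⊤-or-setAt HW
      ... | inj₁ refl = ⊆⊤
      ... | inj₂ (j′ , refl) = first-superset-least i⊂j i⊂W (j-first i⊂W)
  ... | inj₂ no-superset = record
    { vertex = fromℕ v
    ; above = subst (toℕ i <_) (sym (toℕ-fromℕ v)) (toℕ<n i)
    ; ⊂-vertex = subst (setAt i ⊂_) (sym vertexSet-fromℕ) (p⊆q∧p≢q⇒p⊂q ⊆⊤ (proj₂ (setAt-proper i)))
    ; least = λ {W} HW i⊂W → subst (_⊆ W) (sym vertexSet-fromℕ) (⊤-least HW i⊂W)
    }
    where
      ⊤-least : ∀ {W} → H W → setAt i ⊂ W → ⊤ ⊆ W
      ⊤-least HW i⊂W with H⇒⊤-or-setAt HW
      ... | inj₁ refl = ⊆-refl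
      ... | inj₂ (j′ , refl) = contradiction i⊂W (no-superset j′)

  par : Fin v → Fin (suc v)
  par i = Parent.vertex (parent i)

  open Ancestry par (λ i → Parent.above (parent i)) public

  ≼⇒⊆ : ∀ {u w} → u ≼ w → vertexSet u ⊆ vertexSet w
  ≼⇒⊆ ≼-refl = ⊆-refl
  ≼⇒⊆ (≼-step i p) = ⊆-trans i⊆par (≼⇒⊆ p)
    where
      i⊆par : vertexSet (inject₁ i) ⊆ vertexSet (par i)
      i⊆par = subst (_⊆ vertexSet (par i)) (sym (vertexSet-inject₁ i)) (proj₁ (Parent.⊂-vertex (parent i)))

  ⊆⇒≼ : ∀ u w → vertexSet u ⊆ vertexSet w → u ≼ w
  ⊆⇒≼ = upward-induction (λ u → ∀ w → vertexSet u ⊆ vertexSet w → u ≼ w) root-case inject₁-case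
    where
      root-case : ∀ w → vertexSet root ⊆ vertexSet w → root ≼ w
      root-case w root⊆w = subst (root ≼_)
        (vertexSet-injective (⊆-antisym root⊆w (subst (vertexSet w ⊆_) (sym vertexSet-fromℕ) ⊆⊤))) ≼-refl
      inject₁-case : ∀ i → (∀ w → vertexSet (par i) ⊆ vertexSet w → par i ≼ w) →
                     ∀ w → vertexSet (inject₁ i) ⊆ vertexSet w → inject₁ i ≼ w
      inject₁-case i par-case w i⊆w with vertexSet (inject₁ i) ≟ˢ vertexSet w
      ... | yes i≡w = subst (inject₁ i ≼_) (vertexSet-injective i≡w) ≼-refl
      ... | no i≢w = ≼-step i (par-case w (Parent.least (parent i) (vertexSet-H w)
                       (subst (_⊂ vertexSet w) (vertexSet-inject₁ i) (p⊆q∧p≢q⇒p⊂q i⊆w i≢w))))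

  setAt⊂⇒par≼ : ∀ {i u} → setAt i ⊂ vertexSet u → par i ≼ u
  setAt⊂⇒par≼ {i} {u} i⊂u = ⊆⇒≼ (par i) u (Parent.least (parent i) (vertexSet-H u) i⊂u)

  leaf : Fin N → Fin (suc v)
  leaf x = proj₁ (vertexSet-onto (H-⁅⁆ x))

  vertexSet-leaf : ∀ x → vertexSet (leaf x) ≡ ⁅ x ⁆
  vertexSet-leaf x = proj₂ (vertexSet-onto (H-⁅⁆ x))

  ∈⇔leaf≼ : ∀ {x u} → x ∈ vertexSet u ⇔ leaf x ≼ u
  ∈⇔leaf≼ {x} {u} = mk⇔
    (λ x∈u → ⊆⇒≼ (leaf x) u (subst (_⊆ vertexSet u) (sym (vertexSet-leaf x)) (x∈p⇒⁅x⁆⊆p x∈u)))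
    (λ x≼u → ≼⇒⊆ x≼u (subst (x ∈_) (sym (vertexSet-leaf x)) (x∈⁅x⁆ x)))

  leaf-injective : ∀ x y → leaf x ≡ leaf y → x ≡ y
  leaf-injective x y x≡y =
    x∈⁅y⁆⇒x≡y y (subst (x ∈_) (trans (cong vertexSet x≡y) (vertexSet-leaf y)) (from ∈⇔leaf≼ ≼-refl))

  par≢leaf : ∀ x i → par i ≢ leaf x
  par≢leaf x i par≡leaf = nonempty⇒⊄⁅x⁆ (H-nonempty (proj₁ (setAt-proper i)))
    (subst (setAt i ⊂_) (trans (cong vertexSet par≡leaf) (vertexSet-leaf x)) (Parent.⊂-vertex (parent i)))

  -- A point of the parent outside setAt i lies below a second child.
  branching : ∀ u → ∃[ i ] par i ≡ u → ∃[ i ] ∃[ j ] (i ≢ j × par i ≡ u × par j ≡ u)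
  branching u (i , refl) with Parent.⊂-vertex (parent i)
  ... | _ , y , y∈par , y∉i with ≼-child (to ∈⇔leaf≼ y∈par) (par≢leaf y i ∘ sym)
  ...   | j , par-j≡par , y≼j =
    i , j , (λ { refl → y∉i (subst (y ∈_) (vertexSet-inject₁ i) (from ∈⇔leaf≼ y≼j)) }) , refl , par-j≡par

  leaf-onto : ∀ u → (∀ i → par i ≢ u) → ∃[ x ] leaf x ≡ u
  leaf-onto u childless =
    let x , x∈u = H-nonempty (vertexSet-H u)
    in x , decidable-stable (leaf x ≟F u) λ x≢u →
         let i , par≡u , _ = ≼-child (to ∈⇔leaf≼ x∈u) x≢u in childless i par≡u

  tree : EdgeLabeledTree N c
  tree = record
    { v = v ; par = par ; par-up = λ i → Parent.above (parent i) ; branching = branching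
    ; leaf = leaf ; leaf-inj = leaf-injective ; leaf-isLeaf = par≢leaf ; leaf-onto = leaf-onto
    ; lab = label ∘ setAt
    }

module Conditions⇒FitchMap {k n c : ℕ} (ε : EpsMap (suc n) c)
                          (hierarchyLike : HierarchyLike ε) (sizeCond : SizeCond ε) (colourCond : ColourCond ε k) where
  open Neighbourhoods ε

  nbr-nested : ∀ {P Q} → InNbr ε P → InNbr ε Q → Nested P Q
  nbr-nested P∈𝒩 Q∈𝒩 = ∩-trichotomy⇒nested (hierarchyLike _ _ P∈𝒩 Q∈𝒩)

  -- Nestedness leaves only the reverse inclusion, which the size condition turns into equality.
  nbr-⊆ : ∀ {m y y′} → y ∈ nbr ε m y′ → nbr ε m y ⊆ nbr ε m y′
  nbr-⊆ {m} {y} {y′} y∈nbr′ with nbr-nested (y , m , refl) (y′ , m , refl) (y∈nbr m y) y∈nbr′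
  ... | inj₁ nbr⊆nbr′ = nbr⊆nbr′
  ... | inj₂ nbr′⊆nbr = ⊆-reflexive (sym (p⊆q⇒∣q∣≤∣p∣⇒p≡q nbr′⊆nbr (sizeCond y′ m y y∈nbr′)))

  Member : Subset (suc n) → Set
  Member S = S ≡ ⊤ ⊎ (∃[ x ] S ≡ ⁅ x ⁆) ⊎ InNbr ε S

  member? : Decidable Member
  member? S = S ≟ˢ ⊤ ⊎-dec any? (λ x → S ≟ˢ ⁅ x ⁆) ⊎-dec any? (λ y → any? λ m → S ≟ˢ nbr ε m y)

  member-nonempty : ∀ {S} → Member S → Nonempty S
  member-nonempty (inj₁ refl) = fzero , ∈⊤
  member-nonempty (inj₂ (inj₁ (x , refl))) = x , x∈⁅x⁆ x
  member-nonempty (inj₂ (inj₂ (y , m , refl))) = y , y∈nbr m y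

  member-nested : ∀ {P Q} → Member P → Member Q → Nested P Q
  member-nested (inj₁ refl) _ = ⊤-nested
  member-nested (inj₂ (inj₁ (x , refl))) _ = ⁅⁆-nested
  member-nested (inj₂ (inj₂ _)) (inj₁ refl) = nested-sym ⊤-nested
  member-nested (inj₂ (inj₂ _)) (inj₂ (inj₁ (x , refl))) = nested-sym ⁅⁆-nested
  member-nested (inj₂ (inj₂ P∈𝒩)) (inj₂ (inj₂ Q∈𝒩)) = nbr-nested P∈𝒩 Q∈𝒩

  open HierarchyTree Member member? (inj₁ refl) (λ x → inj₂ (inj₁ (x , refl)))
                     member-nonempty member-nested (coloursOf ε)
  open TreeAncestry tree using (EdgeBelow; Explains≼; explains⇔explains≼)

  restricted : Restricted tree k
  restricted i with nonempty? (coloursOf ε (setAt i))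
  ... | yes (m , m∈colours) =
    let y , i≡nbr = to ∈-coloursOf⇔ m∈colours in colourCond (setAt i) (y , m , i≡nbr) (proj₂ (setAt-proper i))
  ... | no empty = subst (_≤ k) (sym (trans (cong ∣_∣ (Empty-unique empty)) (∣⊥∣≡0 c))) z≤n

  -- The edge above the vertex of N_m[y] carries m and lies below the lca, since x ∉ N_m[y].
  edge-of-colour : ∀ {x y m u} (x≢y : x ≢ y) → IsLca u (leaf x) (leaf y) →
                   m ∈ ε x y x≢y → EdgeBelow u (leaf y) m
  edge-of-colour {x} {y} {m} {u} x≢y (x≼u , y≼u , _) m∈ε =
    i , (y≼i , setAt⊂⇒par≼ (i⊆u , x , x∈u , x∉i)) , from ∈-coloursOf⇔ (y , i≡nbr)
    where
      x∉nbr : x ∉ nbr ε m y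
      x∉nbr x∈nbr = to ∈-nbr⇔ x∈nbr x≢y m∈ε
      proper : Proper (nbr ε m y)
      proper = inj₂ (inj₂ (y , m , refl)) , λ nbr≡⊤ → x∉nbr (subst (x ∈_) (sym nbr≡⊤) ∈⊤)
      i = proj₁ (setAt-onto proper)
      i≡nbr : setAt i ≡ nbr ε m y
      i≡nbr = proj₂ (setAt-onto proper)
      y∈i : y ∈ setAt i
      y∈i = subst (y ∈_) (sym i≡nbr) (y∈nbr m y)
      x∉i : x ∉ setAt i
      x∉i = x∉nbr ∘ subst (x ∈_) i≡nbr
      y≼i : leaf y ≼ inject₁ i
      y≼i = to ∈⇔leaf≼ (subst (y ∈_) (sym (vertexSet-inject₁ i)) y∈i)
      x∈u : x ∈ vertexSet u
      x∈u = from ∈⇔leaf≼ x≼u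
      i⊆u : setAt i ⊆ vertexSet u
      i⊆u with member-nested (proj₁ (setAt-proper i)) (vertexSet-H u) y∈i (from ∈⇔leaf≼ y≼u)
      ... | inj₁ i⊆u = i⊆u
      ... | inj₂ u⊆i = ⊥-elim (x∉i (u⊆i x∈u))

  -- If m ∉ ε x y, then x ∈ N_m[y] ⊆ N_m[y'] = setAt i, which puts the lca below the edge.
  colour-of-edge : ∀ {x y m u} (x≢y : x ≢ y) → IsLca u (leaf x) (leaf y) →
                   EdgeBelow u (leaf y) m → m ∈ ε x y x≢y
  colour-of-edge {x} {y} {m} {u} x≢y (_ , _ , least) (i , (y≼i , par≼u) , m∈colours) =
    decidable-stable (m ∈? ε x y x≢y) λ m∉ε →
      let y′ , i≡nbr′ = to ∈-coloursOf⇔ m∈colours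
          y∈i = subst (y ∈_) (vertexSet-inject₁ i) (from ∈⇔leaf≼ y≼i)
          x∈nbr = from ∈-nbr⇔ λ _ → m∉ε
          x∈i = subst (x ∈_) (sym i≡nbr′) (nbr-⊆ {m} {y} {y′} (subst (y ∈_) i≡nbr′ y∈i) x∈nbr)
          x≼i = to ∈⇔leaf≼ (subst (x ∈_) (sym (vertexSet-inject₁ i)) x∈i)
      in par⋠inject₁ i (≼-trans par≼u (least (inject₁ i) x≼i y≼i))

  explains≼ : Explains≼ ε
  explains≼ x y x≢y m u isLca = mk⇔ (edge-of-colour x≢y isLca) (colour-of-edge x≢y isLca)

  isKFitch : IsKFitch k ε
  isKFitch = tree , from explains⇔explains≼ explains≼ , restricted

theorem4 : (k n c : ℕ) (ε : EpsMap (suc n) (suc c)) →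
    IsKFitch k ε ⇔ (HierarchyLike ε × SizeCond ε × ColourCond ε k)
theorem4 k n c ε = mk⇔
  (λ (T , explains , restricted) → let open FitchMap⇒Conditions ε T explains restricted in
    hierarchyLike , sizeCond , colourCond)
  (λ (hierarchyLike , sizeCond , colourCond) → Conditions⇒FitchMap.isKFitch ε hierarchyLike sizeCond colourCond)
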